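{- Let $P$ be a normal logic program and let $M$ be a set of atoms. \begin{enumerate} \item $P$ is a Horn program if and only if $\mathit{mca}(P)$ is a Horn mca-program. \item If $P$ is a Horn program then the least model of $P$ is the only derivable model of $\mathit{mca}(P)$. \item $\{T_P(M)\}=T^{nd}_{\mathit{mca}(P)}(M)$. \item $\mathit{mca}(P^M) = \mathit{mca}(P)^M$. \item $M$ is a model (supported model, stable model) of $P$ if and only if $M$ is a model (supported model, stable model) of $\mathit{mca}(P)$. \end{enumerate}
   Context: Definitions. An mc-atom over a set of atoms $\mathit{At}$ is an expression $kX$ with $k$ a non-negative integer and $X\subseteq\mathit{At}$ finite, $k\le|X|$; a set $M$ satisfies $kX$ iff $|M\cap X|\ge k$, and satisfies $\mathbf{not}(kX)$ iff $|M\cap X|<k$. An mca-clause is $H\leftarrow L_1,\ldots,L_m$ with $H$ an mc-atom (the head $\mathit{hd}(r)$) and $L_i$ mc-literals (the body $\mathit{bd}(r)$); $\mathit{hset}(r)$ is the atom set of the head, and $\mathit{hset}(P)$ is the union of the $\mathit{hset}(r)$, $r\in P$. A clause/program is Horn if no body contains $\mathbf{not}(\cdot)$. $M$ is a model of an mca-program if it satisfies the head of each clause whose body it satisfies. For an mca-program $P$, $P(M)=\{r\in P: M\models\mathit{bd}(r)\}$ and $T^{nd}_P(M)$ is the set of all $M'\subseteq\mathit{hset}(P(M))$ such that $M'\models\mathit{hd}(r)$ for every $r\in P(M)$. $M$ is a supported model of $P$ if $M\in T^{nd}_P(M)$. For a Horn mca-program $P$, a $P$-computation is a sequence $X_0=\emptyset\subseteq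 X_1\subseteq\cdots$ with $X_{n+1}\in T^{nd}_P(X_n)$; a derivable model is the union $\bigcup_n X_n$ of some $P$-computation. The reduct $P^M$ of an mca-program removes every clause having a body literal $\mathbf{not}(A)$ with $M\models A$ and deletes all $\mathbf{not}(A)$ literals from the remaining clauses; $M$ is a stable model of $P$ if $M$ is a derivable model of $P^M$. For a normal clause $r = c\leftarrow a_1,\ldots,a_m,\mathbf{not}(b_1),\ldots,\mathbf{not}(b_n)$, $\mathit{mca}(r)$ is the mca-clause $1\{c\}\leftarrow 1\{a_1\},\ldots,1\{a_m\},\mathbf{not}(1\{b_1\}),\ldots,\mathbf{not}(1\{b_n\})$, and for a normal program $P$, $\mathit{mca}(P)=\{\mathit{mca}(r): r\in P\}$. For a normal program $P$, $T_P$ is the usual one-step provability operator, $P^M$ is the Gelfond–Lifschitz reduct, and models, supported models and stable models have their usual meaning. -}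

module Defs where

open import Data.Nat using (ℕ; suc)
open import Data.List using (List; []; _∷_; map; _++_; length)
open import Data.List.Relation.Unary.All using (All)
open import Data.List.Relation.Unary.Unique.Propositional using (Unique)
open import Data.List.Membership.Propositional using (_∈_)
open import Data.Product using (Σ; _×_; ∃)
open import Data.Empty using (⊥)
open import Data.Unit using (⊤)
open import Relation.Nullary using (¬_)
open import Relation.Binary.PropositionalEquality using (_≡_)

module _ {At : Set} where

  AtSet : Set₁
  AtSet = At → Set

  _⊆_ : AtSet → AtSet → Set
  A ⊆ B = ∀ a → A a → B a

  _≐_ : AtSet → AtSet → Set
  A ≐ B = (A ⊆ B) × (B ⊆ A)

  record NClause : Set where
    constructor _←_∣_
    field
      head : At
      pos  : List At
      neg  : List At
  open NClause public

  NProgram : Set₁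
  NProgram = NClause → Set

  NBodySat : AtSet → NClause → Set
  NBodySat M r = All M (pos r) × All (λ b → ¬ M b) (neg r)

  IsHorn : NProgram → Set
  IsHorn P = ∀ r → P r → neg r ≡ []

  NModel : NProgram → AtSet → Set
  NModel P M = ∀ r → P r → NBodySat M r → M (head r)

  IsLeastModel : NProgram → AtSet → Set₁
  IsLeastModel P M = NModel P M × (∀ N → NModel P N → M ⊆ N)

  T : NProgram → AtSet → AtSet
  T P M c = Σ NClause λ r → P r × head r ≡ c × NBodySat M r

  NSupported : NProgram → AtSet → Set
  NSupported P M = M ≐ T P M

  GL : NProgram → AtSet → NProgram
  GL P M r′ = Σ NClause λ r → P r × All (λ b → ¬ M b) (neg r)
                × (head r ← pos r ∣ []) ≡ r′

  NStable : NProgram → AtSet → Set₁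
  NStable P M = IsLeastModel (GL P M) M

  record MCAtom : Set where
    constructor _⟪_⟫
    field
      k : ℕ
      X : List At
  open MCAtom public

  data MCLit : Set where
    pos′ : MCAtom → MCLit
    not′ : MCAtom → MCLit

  record MCAClause : Set where
    constructor _⇐_
    field
      hd : MCAtom
      bd : List MCLit
  open MCAClause public

  MCAProgram : Set₁
  MCAProgram = MCAClause → Set

  -- M ⊨ kX  iff  |M ∩ X| ≥ k  iff  there are k distinct elements of X in M
  _⊨_ : AtSet → MCAtom → Set
  M ⊨ A = Σ (List At) λ L → Unique L × length L ≡ k A
            × All (_∈ X A) L × All M L

  _⊨L_ : AtSet → MCLit → Set
  M ⊨L pos′ A = M ⊨ A
  M ⊨L not′ A = ¬ (M ⊨ A)

  _⊨B_ : AtSet → List MCLit → Set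
  M ⊨B B = All (M ⊨L_) B

  IsPosLit : MCLit → Set
  IsPosLit (pos′ _) = ⊤
  IsPosLit (not′ _) = ⊥

  IsHornMCA : MCAProgram → Set
  IsHornMCA Q = ∀ r → Q r → All IsPosLit (bd r)

  MModel : MCAProgram → AtSet → Set
  MModel Q M = ∀ r → Q r → M ⊨B bd r → M ⊨ hd r

  hsetP : MCAProgram → AtSet → AtSet
  hsetP Q M a = Σ MCAClause λ r → Q r × M ⊨B bd r × a ∈ X (hd r)

  Tnd : MCAProgram → AtSet → AtSet → Set
  Tnd Q M M′ = (M′ ⊆ hsetP Q M) × (∀ r → Q r → M ⊨B bd r → M′ ⊨ hd r)

  MSupported : MCAProgram → AtSet → Set
  MSupported Q M = Tnd Q M M

  IsComputation : MCAProgram → (ℕ → AtSet) → Set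
  IsComputation Q Xs = (∀ a → ¬ Xs 0 a)
                     × (∀ n → Xs n ⊆ Xs (suc n))
                     × (∀ n → Tnd Q (Xs n) (Xs (suc n)))

  ⋃ : (ℕ → AtSet) → AtSet
  ⋃ Xs a = ∃ λ n → Xs n a

  Derivable : MCAProgram → AtSet → Set₁
  Derivable Q M = Σ (ℕ → AtSet) λ Xs → IsComputation Q Xs × M ≐ ⋃ Xs

  stripNot : List MCLit → List MCLit
  stripNot [] = []
  stripNot (pos′ A ∷ B) = pos′ A ∷ stripNot B
  stripNot (not′ A ∷ B) = stripNot B

  NotFalse : AtSet → MCLit → Set
  NotFalse M (pos′ A) = ⊤
  NotFalse M (not′ A) = ¬ (M ⊨ A)

  MReduct : MCAProgram → AtSet → MCAProgram
  MReduct Q M r′ = Σ MCAClause λ r → Q r × All (NotFalse M) (bd r)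
                     × (hd r ⇐ stripNot (bd r)) ≡ r′

  MStable : MCAProgram → AtSet → Set₁
  MStable Q M = Derivable (MReduct Q M) M

  single : At → MCAtom
  single a = 1 ⟪ a ∷ [] ⟫

  mca : NClause → MCAClause
  mca r = single (head r) ⇐ (map (λ a → pos′ (single a)) (pos r)
                              ++ map (λ b → not′ (single b)) (neg r))

  mcaP : NProgram → MCAProgram
  mcaP P r′ = Σ NClause λ r → P r × mca r ≡ r′

{-# OPTIONS --safe #-}
module Submission where

-- A singleton mc-atom 1{a} holds in M exactly when a ∈ M, so mca translates
-- clause bodies, heads and reducts literally. In particular the non-deterministic
-- operator of mca(P) is deterministic: T^nd_{mca(P)}(M) consists of T_P(M) alone
-- (up to extensional equality). Hence an mca(P)-computation is the Kleene
-- iteration of T_P, whose union is the least model when P is Horn; stability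
-- transfers because mca commutes with the reduct, which is always Horn.

open import Defs
open import Data.Empty using (⊥; ⊥-elim)
open import Data.List using (List; []; _∷_; map; _++_)
open import Data.List.Relation.Unary.All as All using (All; []; _∷_)
open import Data.List.Relation.Unary.All.Properties using (map⁺; map⁻; ++⁺; ++⁻; ++⁻ʳ)
open import Data.List.Relation.Unary.Any using (here; there)
open import Data.List.Relation.Unary.AllPairs using ([]; _∷_)
open import Data.Nat using (ℕ; zero; suc; _+_; _≤_; _≤′_; ≤′-refl; ≤′-step)
open import Data.Nat.Properties using (≤⇒≤′; m≤m+n; m≤n+m)
open import Data.Product using (_×_; _,_; proj₁; proj₂; ∃)
open import Data.Unit using (tt)
open import Function using (_∘_)
open import Function.Bundles using (_⇔_; mk⇔; Equivalence)
import Function.Properties.Equivalence as ⇔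
open import Relation.Nullary using (¬_)
open import Relation.Binary.PropositionalEquality using (_≡_; refl; sym; cong; subst)

open Equivalence using (to; from)

module _ {At : Set} where

  private variable
    a : At
    A B M N M′ : AtSet {At}
    P : NProgram {At}
    Q Q′ : MCAProgram {At}
    Xs : ℕ → AtSet {At}
    m n : ℕ

  ≐-refl : A ≐ A
  ≐-refl = (λ _ x → x) , (λ _ x → x)

  ⊨single⁻ : M ⊨ single a → M a
  ⊨single⁻ (_ ∷ [] , _ , refl , here refl ∷ [] , Ma ∷ []) = Ma
  ⊨single⁻ (_ ∷ [] , _ , refl , there () ∷ [] , _)

  ⊨single⁺ : M a → M ⊨ single a
  ⊨single⁺ {a = a} Ma = a ∷ [] , [] ∷ [] , refl , here refl ∷ [] , Ma ∷ []

  posLit notLit : At → MCLit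
  posLit a = pos′ (single a)
  notLit a = not′ (single a)

  mcaBody : List At → List At → List MCLit
  mcaBody xs ys = map posLit xs ++ map notLit ys

  ⊨B-mca⁻ : ∀ r → M ⊨B bd (mca r) → NBodySat M r
  ⊨B-mca⁻ r sat with ++⁻ (map posLit (pos r)) sat
  ... | sat⁺ , sat⁻ = All.map ⊨single⁻ (map⁻ sat⁺) , All.map (_∘ ⊨single⁺) (map⁻ sat⁻)

  ⊨B-mca⁺ : ∀ r → NBodySat M r → M ⊨B bd (mca r)
  ⊨B-mca⁺ r (in⁺ , out⁻) = ++⁺ (map⁺ (All.map ⊨single⁺ in⁺)) (map⁺ (All.map (_∘ ⊨single⁻) out⁻))

  allPosLit-map⁺ : ∀ xs → All IsPosLit (map posLit xs)
  allPosLit-map⁺ xs = map⁺ (All.universal (λ _ → tt) xs)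

  allPosLit-mcaBody⁻ : ∀ xs ys → All IsPosLit (mcaBody xs ys) → ys ≡ []
  allPosLit-mcaBody⁻ xs []       _ = refl
  allPosLit-mcaBody⁻ xs (y ∷ ys) h with ++⁻ʳ (map posLit xs) h
  ... | () ∷ _

  NotFalse-mcaBody⁻ : ∀ xs ys → All (NotFalse M) (mcaBody xs ys) → All (λ b → ¬ M b) ys
  NotFalse-mcaBody⁻ xs ys h = All.map (_∘ ⊨single⁺) (map⁻ (++⁻ʳ (map posLit xs) h))

  NotFalse-mcaBody⁺ : ∀ xs ys → All (λ b → ¬ M b) ys → All (NotFalse M) (mcaBody xs ys)
  NotFalse-mcaBody⁺ xs ys h =
    ++⁺ (map⁺ (All.universal (λ _ → tt) xs)) (map⁺ (All.map (_∘ ⊨single⁻) h))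

  stripNot-mcaBody : ∀ xs ys → stripNot (mcaBody xs ys) ≡ mcaBody xs []
  stripNot-mcaBody (x ∷ xs) ys       = cong (posLit x ∷_) (stripNot-mcaBody xs ys)
  stripNot-mcaBody []       []       = refl
  stripNot-mcaBody []       (y ∷ ys) = stripNot-mcaBody [] ys

  IsHorn⇔IsHornMCA : (P : NProgram {At}) → IsHorn P ⇔ IsHornMCA (mcaP P)
  IsHorn⇔IsHornMCA P = mk⇔ forth back
    where
    forth : IsHorn P → IsHornMCA (mcaP P)
    forth horn _ (r , Pr , refl) rewrite horn r Pr = ++⁺ (allPosLit-map⁺ (pos r)) []
    back : IsHornMCA (mcaP P) → IsHorn P
    back horn r Pr = allPosLit-mcaBody⁻ (pos r) (neg r) (horn (mca r) (r , Pr , refl))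

  Tnd-mcaP⇔≐T : (P : NProgram {At}) (M M′ : AtSet {At}) → Tnd (mcaP P) M M′ ⇔ (M′ ≐ T P M)
  Tnd-mcaP⇔≐T P M M′ = mk⇔ forth back
    where
    forth : Tnd (mcaP P) M M′ → M′ ≐ T P M
    forth (M′⊆hset , sat) = M′⊆T , T⊆M′
      where
      M′⊆T : M′ ⊆ T P M
      M′⊆T c M′c with M′⊆hset c M′c
      ... | _ , (r , Pr , refl) , body , here c≡hd = r , Pr , sym c≡hd , ⊨B-mca⁻ r body
      ... | _ , (r , Pr , refl) , body , there ()
      T⊆M′ : T P M ⊆ M′
      T⊆M′ _ (r , Pr , refl , body) = ⊨single⁻ (sat (mca r) (r , Pr , refl) (⊨B-mca⁺ r body))
    back : M′ ≐ T P M → Tnd (mcaP P) M M′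
    back (M′⊆T , T⊆M′) = M′⊆hset , sat
      where
      M′⊆hset : M′ ⊆ hsetP (mcaP P) M
      M′⊆hset c M′c with M′⊆T c M′c
      ... | r , Pr , hd≡c , body = mca r , (r , Pr , refl) , ⊨B-mca⁺ r body , here (sym hd≡c)
      sat : ∀ r → mcaP P r → M ⊨B bd r → M′ ⊨ hd r
      sat _ (r , Pr , refl) body = ⊨single⁺ (T⊆M′ _ (r , Pr , refl , ⊨B-mca⁻ r body))

  mcaP-GL⇔MReduct : (P : NProgram {At}) (M : AtSet {At}) →
                    ∀ r → mcaP (GL P M) r ⇔ MReduct (mcaP P) M r
  mcaP-GL⇔MReduct P M _ = mk⇔ forth back
    where
    forth : ∀ {r′} → mcaP (GL P M) r′ → MReduct (mcaP P) M r′
    forth (_ , (r , Pr , out⁻ , refl) , refl) =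
      mca r , (r , Pr , refl) , NotFalse-mcaBody⁺ (pos r) (neg r) out⁻ ,
      cong (single (head r) ⇐_) (stripNot-mcaBody (pos r) (neg r))
    back : ∀ {r′} → MReduct (mcaP P) M r′ → mcaP (GL P M) r′
    back (_ , (r , Pr , refl) , notFalse , refl) =
      (head r ← pos r ∣ []) , (r , Pr , NotFalse-mcaBody⁻ (pos r) (neg r) notFalse , refl) ,
      cong (single (head r) ⇐_) (sym (stripNot-mcaBody (pos r) (neg r)))

  NModel⇔MModel : (P : NProgram {At}) (M : AtSet {At}) → NModel P M ⇔ MModel (mcaP P) M
  NModel⇔MModel P M = mk⇔ forth back
    where
    forth : NModel P M → MModel (mcaP P) M
    forth model _ (r , Pr , refl) body = ⊨single⁺ (model r Pr (⊨B-mca⁻ r body))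
    back : MModel (mcaP P) M → NModel P M
    back model r Pr body = ⊨single⁻ (model (mca r) (r , Pr , refl) (⊨B-mca⁺ r body))

  NSupported⇔MSupported : (P : NProgram {At}) (M : AtSet {At}) →
                          NSupported P M ⇔ MSupported (mcaP P) M
  NSupported⇔MSupported P M = ⇔.sym (Tnd-mcaP⇔≐T P M M)

  NModel-resp-≐ : A ≐ B → NModel P A → NModel P B
  NModel-resp-≐ (A⊆B , B⊆A) model r Pr (in⁺ , out⁻) =
    A⊆B _ (model r Pr (All.map (B⊆A _) in⁺ , All.map (_∘ A⊆B _) out⁻))

  NModel⇒T⊆ : NModel P M → T P M ⊆ M
  NModel⇒T⊆ model _ (r , Pr , refl , body) = model r Pr body

  T-mono : IsHorn P → A ⊆ B → T P A ⊆ T P B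
  T-mono horn A⊆B c (r , Pr , hd≡c , in⁺ , _) =
    r , Pr , hd≡c , All.map (A⊆B _) in⁺ , subst (All _) (sym (horn r Pr)) []

  Increasing : (ℕ → AtSet {At}) → Set
  Increasing Xs = ∀ n → Xs n ⊆ Xs (suc n)

  Increasing⇒mono : Increasing Xs → m ≤ n → Xs m ⊆ Xs n
  Increasing⇒mono {Xs = Xs} {m = m} inc m≤n = go (≤⇒≤′ m≤n)
    where
    go : ∀ {n} → m ≤′ n → Xs m ⊆ Xs n
    go ≤′-refl        _ x = x
    go (≤′-step m≤′n) a x = inc _ a (go m≤′n a x)

  ⋃-finite : Increasing Xs → ∀ xs → All (⋃ Xs) xs → ∃ λ n → All (Xs n) xs
  ⋃-finite inc []       []                 = 0 , []
  ⋃-finite inc (x ∷ xs) ((i , Xᵢx) ∷ rest) with ⋃-finite inc xs rest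
  ... | j , Xⱼxs = j + i , Increasing⇒mono inc (m≤n+m i j) x Xᵢx
                         ∷ All.map (Increasing⇒mono inc (m≤m+n j i) _) Xⱼxs

  module _ (P : NProgram {At}) (comp : IsComputation (mcaP P) Xs) where

    private
      increasing : Increasing Xs
      increasing = proj₁ (proj₂ comp)

    computation-step : ∀ n → Xs (suc n) ≐ T P (Xs n)
    computation-step n = to (Tnd-mcaP⇔≐T P _ _) (proj₂ (proj₂ comp) n)

    ⋃-computation-model : NModel P (⋃ Xs)
    ⋃-computation-model r Pr (in⁺ , out⁻) with ⋃-finite increasing (pos r) in⁺
    ... | n , Xₙpos = suc n , proj₂ (computation-step n) _
                        (r , Pr , refl , Xₙpos , All.map (λ ∉⋃ Xₙb → ∉⋃ (n , Xₙb)) out⁻)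

    ⋃-computation-least : IsHorn P → NModel P N → ⋃ Xs ⊆ N
    ⋃-computation-least {N = N} horn model a (n , Xₙa) = stage⊆N n a Xₙa
      where
      stage⊆N : ∀ n → Xs n ⊆ N
      stage⊆N zero    a X₀a = ⊥-elim (proj₁ comp a X₀a)
      stage⊆N (suc n) a Xₙ₊₁a =
        NModel⇒T⊆ model a (T-mono horn (stage⊆N n) a (proj₁ (computation-step n) a Xₙ₊₁a))

  iterate : NProgram {At} → ℕ → AtSet {At}
  iterate P zero    _ = ⊥
  iterate P (suc n)   = T P (iterate P n)

  iterate-increasing : IsHorn P → Increasing (iterate P)
  iterate-increasing horn zero    _ ()
  iterate-increasing horn (suc n)   = T-mono horn (iterate-increasing horn n)

  iterate-computation : IsHorn P → IsComputation (mcaP P) (iterate P)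
  iterate-computation {P = P} horn =
    (λ _ ()) , iterate-increasing horn , λ n → from (Tnd-mcaP⇔≐T P _ _) ≐-refl

  IsLeastModel⇔Derivable : IsHorn P → ∀ N → IsLeastModel P N ⇔ Derivable (mcaP P) N
  IsLeastModel⇔Derivable {P = P} horn N = mk⇔ forth back
    where
    forth : IsLeastModel P N → Derivable (mcaP P) N
    forth (model , least) =
      iterate P , comp , least _ (⋃-computation-model P comp) , ⋃-computation-least P comp horn model
      where comp = iterate-computation horn
    back : Derivable (mcaP P) N → IsLeastModel P N
    back (Xs , comp , N⊆⋃ , ⋃⊆N) =
      NModel-resp-≐ (⋃⊆N , N⊆⋃) (⋃-computation-model P comp) ,
      λ N′ model a Na → ⋃-computation-least P comp horn model a (N⊆⋃ a Na)

  Tnd-cong : (∀ r → Q r ⇔ Q′ r) → Tnd Q M M′ → Tnd Q′ M M′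
  Tnd-cong Q⇔Q′ (M′⊆hset , sat) =
    (λ a M′a → let r , Qr , body , a∈hd = M′⊆hset a M′a in r , to (Q⇔Q′ r) Qr , body , a∈hd) ,
    (λ r Q′r → sat r (from (Q⇔Q′ r) Q′r))

  Derivable-cong : (∀ r → Q r ⇔ Q′ r) → Derivable Q M ⇔ Derivable Q′ M
  Derivable-cong Q⇔Q′ = mk⇔ (transfer Q⇔Q′) (transfer (⇔.sym ∘ Q⇔Q′))
    where
    transfer : ∀ {Q Q′} → (∀ r → Q r ⇔ Q′ r) → Derivable Q M → Derivable Q′ M
    transfer Q⇔Q′ (Xs , (empty , inc , steps) , M≐⋃) =
      Xs , (empty , inc , Tnd-cong Q⇔Q′ ∘ steps) , M≐⋃

  GL-isHorn : (P : NProgram {At}) (M : AtSet {At}) → IsHorn (GL P M)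
  GL-isHorn P M _ (r , _ , _ , refl) = refl

  NStable⇔MStable : (P : NProgram {At}) (M : AtSet {At}) → NStable P M ⇔ MStable (mcaP P) M
  NStable⇔MStable P M =
    ⇔.trans (IsLeastModel⇔Derivable (GL-isHorn P M) M) (Derivable-cong (mcaP-GL⇔MReduct P M))

theorem4 : {At : Set} (P : NProgram {At}) (M : AtSet {At}) →
    (IsHorn P ⇔ IsHornMCA (mcaP P))
  × (IsHorn P →
       (∀ N → IsLeastModel P N → Derivable (mcaP P) N)
     × (∀ N → Derivable (mcaP P) N → IsLeastModel P N))
  × (∀ M′ → Tnd (mcaP P) M M′ ⇔ (M′ ≐ T P M))
  × (∀ r → mcaP (GL P M) r ⇔ MReduct (mcaP P) M r)
  × (NModel P M ⇔ MModel (mcaP P) M)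
  × (NSupported P M ⇔ MSupported (mcaP P) M)
  × (NStable P M ⇔ MStable (mcaP P) M)
theorem4 P M =
    IsHorn⇔IsHornMCA P
  , (λ horn → (λ N → to (IsLeastModel⇔Derivable horn N))
            , (λ N → from (IsLeastModel⇔Derivable horn N)))
  , Tnd-mcaP⇔≐T P M
  , mcaP-GL⇔MReduct P M
  , NModel⇔MModel P M
  , NSupported⇔MSupported P M
  , NStable⇔MStable P M
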